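{- (1) $1\mathrm{N}\subsetneqq \mathrm{co}\text{ - }1\mathrm{C}_{=}$ and $\mathrm{co}\text{ - }1\mathrm{N}\subsetneqq 1\mathrm{C}_{=}$. (2) $1\mathrm{N}\nsubseteq 1\mathrm{C}_{=}$.
   Context: A one-way nondeterministic finite automaton (1nfa) is $M=(Q,\Sigma,\{\rhd,\lhd\},\delta,q_0,Q_{acc},Q_{rej})$: finite state set $Q$, input alphabet $\Sigma$, endmarkers $\rhd,\lhd\notin\Sigma$, disjoint sets $Q_{acc},Q_{rej}\subseteq Q$ of accepting and rejecting states (halting states $Q_{halt}=Q_{acc}\cup Q_{rej}$), and transition function $\delta:(Q-Q_{halt})\times(\Sigma\cup\{\rhd,\lhd\})\to\mathcal P(Q)$. On input $x$ it reads $\rhd x\lhd$ left to right, moving its head one cell right at every step (no $\lambda$-moves), and halts when entering a halting state. A computation path is accepting (resp. rejecting) if it enters a state of $Q_{acc}$ (resp. $Q_{rej}$); a path that reads off $\lhd$ without entering a halting state is neither. $\#M(x)$ and $\#\overline{M}(x)$ denote the numbers of accepting and of rejecting computation paths of $M$ on $x$. The state complexity of $M$ is $|Q|$; a family $\{M_n\}_{n\in\mathbb N}$ has polynomial size if the state complexity of $M_n$ is at most $p(n)$ for a fixed polynomial $p$. A family of promise problems over a fixed alphabet $\Sigma$ is $\mathcal L=\{(L_n^{(+)},L_n^{(-)})\}_{n\in\mathbb N}$ with $L_n^{(+)},L_n^{(-)}\subseteq\Sigma^*$ disjoint. Its complement is $\mathrm{co}\text{ - }\mathcal L=\{(L_n^{(-)},L_n^{(+)})\}_n$,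 and for a class $\mathcal C$ of such families, $\mathrm{co}\text{ - }\mathcal C=\{\mathrm{co}\text{ - }\mathcal L:\mathcal L\in\mathcal C\}$. A family of partial functions is $\{(f_n,D_n)\}_n$ with $f_n$ defined on $D_n\subseteq\Sigma^*$. $1\#$ is the class of such families for which some polynomial-size family of 1nfa's $\{M_n\}$ satisfies $f_n(x)=\#M_n(x)$ for all $n$ and $x\in D_n$; $1\mathrm{Gap}$ is defined the same way with $f_n(x)=\#M_n(x)-\#\overline{M}_n(x)$. $\mathcal L\in 1\mathrm N$ iff there is $\{(f_n,D_n)\}\in1\#$ with $L_n^{(+)}\cup L_n^{(-)}\subseteq D_n$, $f_n(x)>0$ for $x\in L_n^{(+)}$ and $f_n(x)=0$ for $x\in L_n^{(-)}$, for all $n$. $\mathcal L\in 1\mathrm C_{=}$ iff there is $\{(f_n,D_n)\}\in1\mathrm{Gap}$ with $L_n^{(+)}\cup L_n^{(-)}\subseteq D_n$, $f_n(x)=0$ for $x\in L_n^{(+)}$ and $f_n(x)\neq0$ for $x\in L_n^{(-)}$, for all $n$. -}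

module Defs where

open import Data.Nat using (ℕ; zero; suc; _+_; _*_; _≤_; _<_)
open import Data.Integer as ℤ using (ℤ; +_)
open import Data.Fin using (Fin)
open import Data.Bool using (Bool; true; false; if_then_else_; _∨_)
open import Data.List using (List; []; _∷_; map; _++_; allFin)
open import Data.Nat.ListAction using (sum)
open import Data.Product using (Σ; ∃; _×_; _,_)
open import Data.Empty using (⊥)
open import Relation.Nullary using (¬_)
open import Relation.Binary.PropositionalEquality using (_≡_)
open import Level using (0ℓ) renaming (suc to lsuc)

Str : ℕ → Set
Str s = List (Fin s)

data TapeSym (s : ℕ) : Set where
  lend : TapeSym s               -- ▷
  rend : TapeSym s               -- ◁
  sym  : Fin s → TapeSym s

tape : ∀ {s} → Str s → List (TapeSym s)
tape x = lend ∷ (map sym x ++ (rend ∷ []))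

-- One-way nondeterministic finite automata (no λ-moves).
-- States are Fin states.  δ q a is a subset of Q, given as a
-- characteristic function.  δ is (harmlessly) total; its values on
-- halting states are never used.

record NFA (s : ℕ) : Set where
  field
    states : ℕ
    δ      : Fin states → TapeSym s → Fin states → Bool
    q₀     : Fin states
    acc    : Fin states → Bool
    rej    : Fin states → Bool
    disj   : ∀ q → acc q ≡ true → rej q ≡ false

  -- A path that reads off the tape without halting counts for nothing.
  paths : (Fin states → Bool) → Fin states → List (TapeSym s) → ℕ
  paths target q w with acc q ∨ rej q
  ... | true  = if target q then 1 else 0
  paths target q [] | false = 0
  paths target q (a ∷ w) | false =
    sum (map (λ q' → if δ q a q' then paths target q' w else 0) (allFin states))

  #acc : Str s → ℕ
  #acc x = paths acc q₀ (tape x)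

  #rej : Str s → ℕ
  #rej x = paths rej q₀ (tape x)

  gap : Str s → ℤ
  gap x = (+ #acc x) ℤ.- (+ #rej x)

open NFA public

-- Polynomials with natural-number coefficients (list of coefficients,
-- constant term first).

evalPoly : List ℕ → ℕ → ℕ
evalPoly []       n = 0
evalPoly (c ∷ cs) n = c + n * evalPoly cs n

PolySize : ∀ {s} → (ℕ → NFA s) → Set
PolySize M = Σ (List ℕ) λ p → ∀ n → states (M n) ≤ evalPoly p n

record PromiseFamily (s : ℕ) : Set₁ where
  field
    Lpos : ℕ → Str s → Set
    Lneg : ℕ → Str s → Set
    disjoint : ∀ n x → Lpos n x → Lneg n x → ⊥

open PromiseFamily public

co : ∀ {s} → PromiseFamily s → PromiseFamily s
co L = record { Lpos = Lneg L ; Lneg = Lpos L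
              ; disjoint = λ n x p q → disjoint L n x q p }

record PartialFamily (s : ℕ) (A : Set) : Set₁ where
  field
    Dom : ℕ → Str s → Set
    fun : (n : ℕ) → (x : Str s) → Dom n x → A

open PartialFamily public

Sharp1 : ∀ {s} → PartialFamily s ℕ → Set
Sharp1 {s} F = Σ (ℕ → NFA s) λ M → PolySize M ×
  (∀ n x (d : Dom F n x) → fun F n x d ≡ #acc (M n) x)

Gap1 : ∀ {s} → PartialFamily s ℤ → Set
Gap1 {s} F = Σ (ℕ → NFA s) λ M → PolySize M ×
  (∀ n x (d : Dom F n x) → fun F n x d ≡ gap (M n) x)

Class : Set₂
Class = ∀ {s} → PromiseFamily s → Set₁

OneN : Class
OneN {s} L = Σ (PartialFamily s ℕ) λ F → Sharp1 F ×
  ((∀ n x → Lpos L n x → Σ (Dom F n x) λ d → 0 < fun F n x d) ×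
   (∀ n x → Lneg L n x → Σ (Dom F n x) λ d → fun F n x d ≡ 0))

OneCeq : Class
OneCeq {s} L = Σ (PartialFamily s ℤ) λ F → Gap1 F ×
  ((∀ n x → Lpos L n x → Σ (Dom F n x) λ d → fun F n x d ≡ + 0) ×
   (∀ n x → Lneg L n x → Σ (Dom F n x) λ d → ¬ (fun F n x d ≡ + 0)))

coC : Class → Class
coC C L = C (co L)

_⊆C_ : Class → Class → Set₁
C ⊆C D = ∀ {s} (L : PromiseFamily s) → C L → D L

_⊊C_ : Class → Class → Set₁
C ⊊C D = (C ⊆C D) × Σ ℕ λ s → Σ (PromiseFamily s) λ L → D L × ¬ C L

-- Splitting a computation after the prefix ▷u shows that the number of accepting paths on uv
-- is a sum over cuts c (a state, or "already halted") of r_u(c) · p_v(c), with |Q| + 1 cuts;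
-- the same holds for the gap over ℤ. Hence the matrix (gap(u_i v_j)) has rank at most |Q| + 1,
-- and if #acc(u_i v_i) = 0 while #acc(u_i v_j) > 0 for i before j, the supports of the rows
-- r_{u_i} are pairwise distinct, so there are at most 2^(|Q|+1) indices.
-- A 1nfa whose rejecting states become dead ends has gap #acc, which gives 1N ⊆ co-1C=.
-- Unequal numbers of 0s and 1s is in co-1C= (the gap can be #0 − #1) but not in 1N, by the
-- fooling set (0^i, 1^i). Inequality of u, v ∈ {0,1}^n, written u#vᴿ, is in 1N by guessing a
-- position where they differ, but not in 1C=: that would give a 2^n × 2^n diagonal gap matrix,
-- of rank 2^n > poly(n) + 1.

module Submission where

open import Defs
open import Algebra.Properties.CommutativeSemigroup using (interchange; x∙yz≈y∙xz)
open import Data.Bool as Bool using (Bool; true; false; if_then_else_; _∨_; _∧_; not)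
open import Data.Empty using (⊥-elim)
open import Data.Fin as Fin using (Fin; zero; suc; toℕ)
import Data.Fin.Properties as FinP
open import Data.Integer as ℤ using (ℤ; +_; 0ℤ; 1ℤ)
import Data.Integer.Properties as ℤ
open import Data.Integer.Tactic.RingSolver using (solve-∀)
open import Data.List using (List; []; _∷_; map; _++_; allFin; length; filter; reverse; _ʳ++_; replicate; upTo)
open import Data.List.Membership.Propositional using (_∈_; find; lose)
open import Data.List.Membership.Propositional.Properties
  using (∈-allFin; ∈-∃++; ∈-++⁻; ∈-++⁺ˡ; ∈-++⁺ʳ; ∈-map⁻; ∈-map⁺; ∈-filter⁻; ∈-filter⁺)
open import Data.List.Properties
  using (length-++; length-++-sucʳ; length-map; length-reverse; length-tabulate; length-upTo; map-++; map-injective;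
         map-tabulate; reverse-++; reverse-injective; ++-assoc; ʳ++-defn; ∷-injectiveˡ; ∷-injectiveʳ)
open import Data.List.Relation.Unary.All as All using (All; []; _∷_)
import Data.List.Relation.Unary.All.Properties as AllP
open import Data.List.Relation.Unary.AllPairs as AllPairs using (AllPairs; []; _∷_)
import Data.List.Relation.Unary.AllPairs.Properties as AllPairsP
open import Data.List.Relation.Unary.Any using (here; there; any?)
open import Data.List.Relation.Unary.Unique.Propositional using (Unique)
import Data.List.Relation.Unary.Unique.Propositional.Properties as UniqueP
open import Data.Maybe using (Maybe; just; nothing)
open import Data.Nat as ℕ using (ℕ; zero; suc; _+_; _*_; _≤_; _<_; z≤n; s≤s; _^_)
open import Data.Nat.ListAction using (sum)
import Data.Nat.Properties as ℕ
import Data.Nat.Tactic.RingSolver as ℕ-Solver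
open import Data.Product using (∃; _×_; _,_; proj₁; proj₂; uncurry)
open import Data.Sum using (_⊎_; inj₁; inj₂; [_,_]′)
open import Data.Unit using (⊤; tt)
open import Function using (id; _∘_)
open import Relation.Binary.PropositionalEquality as ≡
  using (_≡_; _≢_; refl; cong; cong₂; trans; subst; module ≡-Reasoning)
open import Relation.Nullary using (¬_; ¬?; Dec; yes; no; does; _×-dec_)
open import Relation.Nullary.Decidable using (dec-true)
import Relation.Unary as U
open import Relation.Unary.Properties using (∁?)

private variable A B : Set

sumℕ : List A → (A → ℕ) → ℕ
sumℕ xs f = sum (map f xs)

syntax sumℕ xs (λ x → e) = ∑ℕ[ x ∈ xs ] e

∑ℕ-cong : ∀ xs {f g : A → ℕ} → (∀ x → f x ≡ g x) → sumℕ xs f ≡ sumℕ xs g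
∑ℕ-cong []       f≗g = refl
∑ℕ-cong (x ∷ xs) f≗g = cong₂ _+_ (f≗g x) (∑ℕ-cong xs f≗g)

∑ℕ-zero : ∀ xs {f : A → ℕ} → (∀ x → f x ≡ 0) → sumℕ xs f ≡ 0
∑ℕ-zero []       f≗0 = refl
∑ℕ-zero (x ∷ xs) f≗0 rewrite f≗0 x = ∑ℕ-zero xs f≗0

∑ℕ-+ : ∀ xs (f g : A → ℕ) → ∑ℕ[ x ∈ xs ] (f x + g x) ≡ sumℕ xs f + sumℕ xs g
∑ℕ-+ []       f g = refl
∑ℕ-+ (x ∷ xs) f g rewrite ∑ℕ-+ xs f g = interchange ℕ.+-commutativeSemigroup (f x) (g x) (sumℕ xs f) (sumℕ xs g)

∑ℕ-*ʳ : ∀ xs (f : A → ℕ) c → sumℕ xs f * c ≡ ∑ℕ[ x ∈ xs ] (f x * c)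
∑ℕ-*ʳ []       f c = refl
∑ℕ-*ʳ (x ∷ xs) f c rewrite ℕ.*-distribʳ-+ c (f x) (sumℕ xs f) | ∑ℕ-*ʳ xs f c = refl

∑ℕ-comm : (xs : List A) (ys : List B) (h : A → B → ℕ) →
          ∑ℕ[ x ∈ xs ] sumℕ ys (h x) ≡ ∑ℕ[ y ∈ ys ] ∑ℕ[ x ∈ xs ] h x y
∑ℕ-comm []       ys h = ≡.sym (∑ℕ-zero ys (λ _ → refl))
∑ℕ-comm (x ∷ xs) ys h rewrite ∑ℕ-comm xs ys h = ≡.sym (∑ℕ-+ ys (h x) (λ y → ∑ℕ[ x ∈ xs ] h x y))

∑ℕ-map : (g : B → A) (xs : List B) (f : A → ℕ) → sumℕ (map g xs) f ≡ ∑ℕ[ x ∈ xs ] f (g x)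
∑ℕ-map g []       f = refl
∑ℕ-map g (x ∷ xs) f = cong (_+_ (f (g x))) (∑ℕ-map g xs f)

∈⇒≤∑ℕ : ∀ {xs x} (f : A → ℕ) → x ∈ xs → f x ≤ sumℕ xs f
∈⇒≤∑ℕ {xs = y ∷ xs} f (here refl) = ℕ.m≤m+n (f y) (sumℕ xs f)
∈⇒≤∑ℕ {xs = y ∷ xs} f (there x∈xs) = ℕ.≤-trans (∈⇒≤∑ℕ f x∈xs) (ℕ.m≤n+m (sumℕ xs f) (f y))

if-+ : ∀ b x y → (if b then x + y else 0) ≡ (if b then x else 0) + (if b then y else 0)
if-+ true  x y = refl
if-+ false x y = refl

if-∑ℕ : ∀ b (xs : List A) (f : A → ℕ) → (if b then sumℕ xs f else 0) ≡ ∑ℕ[ x ∈ xs ] (if b then f x else 0)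
if-∑ℕ true  xs f = refl
if-∑ℕ false xs f = ≡.sym (∑ℕ-zero xs (λ _ → refl))

if-*ʳ : ∀ b x c → (if b then x else 0) * c ≡ (if b then x * c else 0)
if-*ʳ true  x c = refl
if-*ʳ false x c = refl

∑ℕ-allFin-suc : ∀ {n} (f : Fin (suc n) → ℕ) → sumℕ (allFin (suc n)) f ≡ f zero + ∑ℕ[ i ∈ allFin n ] f (suc i)
∑ℕ-allFin-suc {n} f =
  cong (_+_ (f zero)) (trans (cong (sum ∘ map f) (≡.sym (map-tabulate id suc))) (∑ℕ-map suc (allFin n) f))

indicator : ∀ {n} → Fin n → Fin n → ℕ
indicator i j = if does (i Fin.≟ j) then 1 else 0

∑ℕ-allFin-indicator : ∀ {n} (i : Fin n) (g : Fin n → ℕ) → ∑ℕ[ j ∈ allFin n ] (indicator i j * g j) ≡ g i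
∑ℕ-allFin-indicator {suc n} zero    g = begin
  sumℕ (allFin (suc n)) (λ j → indicator zero j * g j) ≡⟨ ∑ℕ-allFin-suc (λ j → indicator zero j * g j) ⟩
  1 * g zero + ∑ℕ[ j ∈ allFin n ] 0                    ≡⟨ cong₂ _+_ (ℕ.*-identityˡ (g zero)) (∑ℕ-zero (allFin n) (λ _ → refl)) ⟩
  g zero + 0                                           ≡⟨ ℕ.+-identityʳ (g zero) ⟩
  g zero                                               ∎
  where open ≡-Reasoning
∑ℕ-allFin-indicator {suc n} (suc i) g = begin
  sumℕ (allFin (suc n)) (λ j → indicator (suc i) j * g j) ≡⟨ ∑ℕ-allFin-suc (λ j → indicator (suc i) j * g j) ⟩
  ∑ℕ[ j ∈ allFin n ] (indicator i j * g (suc j))          ≡⟨ ∑ℕ-allFin-indicator i (λ j → g (suc j)) ⟩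
  g (suc i)                                               ∎
  where open ≡-Reasoning

sumℤ : List A → (A → ℤ) → ℤ
sumℤ []       f = 0ℤ
sumℤ (x ∷ xs) f = f x ℤ.+ sumℤ xs f

syntax sumℤ xs (λ x → e) = ∑ℤ[ x ∈ xs ] e

∑ℤ-cong : ∀ xs {f g : A → ℤ} → (∀ x → f x ≡ g x) → sumℤ xs f ≡ sumℤ xs g
∑ℤ-cong []       f≗g = refl
∑ℤ-cong (x ∷ xs) f≗g = cong₂ ℤ._+_ (f≗g x) (∑ℤ-cong xs f≗g)

∑ℤ-− : ∀ xs (f g : A → ℤ) → ∑ℤ[ x ∈ xs ] (f x ℤ.- g x) ≡ sumℤ xs f ℤ.- sumℤ xs g
∑ℤ-− []       f g = refl
∑ℤ-− (x ∷ xs) f g rewrite ∑ℤ-− xs f g = lemma (f x) (g x) (sumℤ xs f) (sumℤ xs g)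
  where
  lemma : ∀ a b c d → a ℤ.- b ℤ.+ (c ℤ.- d) ≡ a ℤ.+ c ℤ.- (b ℤ.+ d)
  lemma = solve-∀

∑ℤ-*ˡ : ∀ xs c (f : A → ℤ) → c ℤ.* sumℤ xs f ≡ ∑ℤ[ x ∈ xs ] (c ℤ.* f x)
∑ℤ-*ˡ []       c f = ℤ.*-zeroʳ c
∑ℤ-*ˡ (x ∷ xs) c f = trans (ℤ.*-distribˡ-+ c (f x) (sumℤ xs f)) (cong (ℤ._+_ (c ℤ.* f x)) (∑ℤ-*ˡ xs c f))

∑ℤ-++-∷ : ∀ xs y ys (f : A → ℤ) → sumℤ (xs ++ y ∷ ys) f ≡ f y ℤ.+ sumℤ (xs ++ ys) f
∑ℤ-++-∷ []       y ys f = refl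
∑ℤ-++-∷ (x ∷ xs) y ys f rewrite ∑ℤ-++-∷ xs y ys f =
  x∙yz≈y∙xz ℤ.+-commutativeSemigroup (f x) (f y) (sumℤ (xs ++ ys) f)

+-∑ℕ : ∀ xs (f : A → ℕ) → + (sumℕ xs f) ≡ ∑ℤ[ x ∈ xs ] (+ f x)
+-∑ℕ []       f = refl
+-∑ℕ (x ∷ xs) f = trans (ℤ.pos-+ (f x) (sumℕ xs f)) (cong (ℤ._+_ (+ f x)) (+-∑ℕ xs f))

∑ℤ≢0⇒∃≢0 : ∀ xs (f : A → ℤ) → sumℤ xs f ≢ 0ℤ → ∃ λ x → x ∈ xs × f x ≢ 0ℤ
∑ℤ≢0⇒∃≢0 []       f ∑≢0 = ⊥-elim (∑≢0 refl)
∑ℤ≢0⇒∃≢0 (x ∷ xs) f ∑≢0 with f x ℤ.≟ 0ℤ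
... | no  fx≢0 = x , here refl , fx≢0
... | yes fx≡0 with ∑ℤ≢0⇒∃≢0 xs f (λ ∑≡0 → ∑≢0 (cong₂ ℤ._+_ fx≡0 ∑≡0))
...   | y , y∈xs , fy≢0 = y , there y∈xs , fy≢0

length-filter+length-filter-∁ : ∀ {P : A → Set} (P? : U.Decidable P) xs →
                                length (filter P? xs) + length (filter (∁? P?) xs) ≡ length xs
length-filter+length-filter-∁ P? []       = refl
length-filter+length-filter-∁ P? (x ∷ xs) with P? x
... | yes _ = cong suc (length-filter+length-filter-∁ P? xs)
... | no  _ = trans (ℕ.+-suc _ _) (cong suc (length-filter+length-filter-∁ P? xs))

AllPairs-mapWith-All : ∀ {P : A → Set} {R S : A → A → Set} {xs} → All P xs →
                       (∀ {x y} → P x → P y → R x y → S x y) → AllPairs R xs → AllPairs S xs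
AllPairs-mapWith-All []         f []           = []
AllPairs-mapWith-All (px ∷ pxs) f (rxs ∷ rxss) =
  All.zipWith (λ (py , rxy) → f px py rxy) (pxs , rxs) ∷ AllPairs-mapWith-All pxs f rxss

-- Fooling sets and rank

module _ {I K : Set} where

  fooling-bound : ∀ (ks : List K) (r p : I → K → ℕ) {xs : List I} →
                  All (λ i → ∑ℕ[ k ∈ ks ] (r i k * p i k) ≡ 0) xs →
                  AllPairs (λ i j → 0 < ∑ℕ[ k ∈ ks ] (r i k * p j k)) xs →
                  length xs ≤ 2 ^ length ks
  fooling-bound []       r p {[]}        _ _                = z≤n
  fooling-bound []       r p {_ ∷ []}    _ _                = s≤s z≤n
  fooling-bound []       r p {_ ∷ _ ∷ _} _ ((() ∷ _) ∷ _)
  fooling-bound (k ∷ ks) r p {xs} diag pairs = begin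
    length xs                     ≡⟨ length-filter+length-filter-∁ r-vanishes? xs ⟨
    length ys + length zs         ≤⟨ ℕ.+-mono-≤ (uncurry (fooling-bound ks r p) on-ys) (uncurry (fooling-bound ks r p) on-zs) ⟩
    2 ^ length ks + 2 ^ length ks ≡⟨ cong (_+_ (2 ^ length ks)) (ℕ.+-identityʳ _) ⟨
    2 ^ length (k ∷ ks)           ∎
    where
    open ℕ.≤-Reasoning
    F : I → I → ℕ
    F i j = ∑ℕ[ k ∈ ks ] (r i k * p j k)
    r-vanishes? : U.Decidable (λ i → r i k ≡ 0)
    r-vanishes? i = r i k ℕ.≟ 0
    ys zs : List I
    ys = filter r-vanishes? xs
    zs = filter (∁? r-vanishes?) xs
    drop-k : ∀ {P : I → Set} {xs} → (∀ {i j} → P i → P j → r i k * p j k ≡ 0) → All P xs →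
             All (λ i → r i k * p i k + F i i ≡ 0) xs → AllPairs (λ i j → 0 < r i k * p j k + F i j) xs →
             All (λ i → F i i ≡ 0) xs × AllPairs (λ i j → 0 < F i j) xs
    drop-k vanish Ps diag pairs =
      All.zipWith (λ {i} (Pi , d) → trans (cong (_+ F i i) (≡.sym (vanish Pi Pi))) d) (Ps , diag) ,
      AllPairs-mapWith-All Ps (λ {i} {j} Pi Pj lt → subst (λ x → 0 < x + F i j) (vanish Pi Pj) lt) pairs
    on-ys : All (λ i → F i i ≡ 0) ys × AllPairs (λ i j → 0 < F i j) ys
    on-ys = drop-k (λ {_} {j} rik≡0 _ → cong (_* p j k) rik≡0) (AllP.all-filter r-vanishes? xs)
                   (AllP.filter⁺ r-vanishes? diag) (AllPairsP.filter⁺ r-vanishes? pairs)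
    p-vanishes : ∀ {j} → r j k ≢ 0 → r j k * p j k + F j j ≡ 0 → p j k ≡ 0
    p-vanishes {j} rjk≢0 d with ℕ.m*n≡0⇒m≡0∨n≡0 (r j k) (ℕ.m+n≡0⇒m≡0 _ d)
    ... | inj₁ rjk≡0 = ⊥-elim (rjk≢0 rjk≡0)
    ... | inj₂ pjk≡0 = pjk≡0
    on-zs : All (λ i → F i i ≡ 0) zs × AllPairs (λ i j → 0 < F i j) zs
    on-zs = drop-k (λ {i} _ pjk≡0 → trans (cong (r i k *_) pjk≡0) (ℕ.*-zeroʳ (r i k)))
                   (All.zipWith (uncurry p-vanishes) (AllP.all-filter (∁? r-vanishes?) xs , AllP.filter⁺ (∁? r-vanishes?) diag))
                   (AllP.filter⁺ (∁? r-vanishes?) diag) (AllPairsP.filter⁺ (∁? r-vanishes?) pairs)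

  rank-bound : ∀ (ks : List K) (r p : I → K → ℤ) {xs : List I} →
               All (λ i → ∑ℤ[ k ∈ ks ] (r i k ℤ.* p i k) ≢ 0ℤ) xs →
               AllPairs (λ i j → ∑ℤ[ k ∈ ks ] (r i k ℤ.* p j k) ≡ 0ℤ) xs →
               length xs ≤ length ks
  rank-bound ks r p {[]}     _           _               = z≤n
  rank-bound ks r p {i ∷ xs} (Fᵢᵢ≢0 ∷ diag) (Fᵢ≡0 ∷ pairs)
    with k , k∈ks , term≢0 ← ∑ℤ≢0⇒∃≢0 ks (λ k → r i k ℤ.* p i k) Fᵢᵢ≢0
    with ks₁ , ks₂ , refl ← ∈-∃++ k∈ks
    = subst (suc (length xs) ≤_) (≡.sym (length-++-sucʳ ks₁ k ks₂))
            (s≤s (rank-bound (ks₁ ++ ks₂) r′ p diag′ pairs′))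
    where
    a : ℤ
    a = r i k
    a≢0 : a ≢ 0ℤ
    a≢0 a≡0 = term≢0 (trans (cong (ℤ._* p i k) a≡0) (ℤ.*-zeroˡ (p i k)))
    F F′ : I → I → ℤ
    F  j l = ∑ℤ[ k ∈ ks₁ ++ k ∷ ks₂ ] (r j k ℤ.* p l k)
    -- eliminate the k-th coordinate using row i as pivot
    r′ : I → K → ℤ
    r′ j k′ = a ℤ.* r j k′ ℤ.- r j k ℤ.* r i k′
    F′ j l = ∑ℤ[ k ∈ ks₁ ++ ks₂ ] (r′ j k ℤ.* p l k)
    eliminate : ∀ j l → F′ j l ≡ a ℤ.* F j l ℤ.- r j k ℤ.* F i l
    eliminate j l = begin
      F′ j l
        ≡⟨ ∑ℤ-cong (ks₁ ++ ks₂) (λ k′ → distrib a (r j k′) (r j k) (r i k′) (p l k′)) ⟩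
      ∑ℤ[ k′ ∈ ks₁ ++ ks₂ ] (a ℤ.* (r j k′ ℤ.* p l k′) ℤ.- r j k ℤ.* (r i k′ ℤ.* p l k′))
        ≡⟨ ∑ℤ-− (ks₁ ++ ks₂) _ _ ⟩
      ∑ℤ[ k′ ∈ ks₁ ++ ks₂ ] (a ℤ.* (r j k′ ℤ.* p l k′))
        ℤ.- ∑ℤ[ k′ ∈ ks₁ ++ ks₂ ] (r j k ℤ.* (r i k′ ℤ.* p l k′))
        ≡⟨ cong₂ ℤ._-_ (∑ℤ-*ˡ (ks₁ ++ ks₂) a _) (∑ℤ-*ˡ (ks₁ ++ ks₂) (r j k) _) ⟨
      a ℤ.* Fⱼ ℤ.- r j k ℤ.* Fᵢ
        ≡⟨ cancel a (r j k) (p l k) Fⱼ Fᵢ ⟩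
      a ℤ.* (r j k ℤ.* p l k ℤ.+ Fⱼ) ℤ.- r j k ℤ.* (a ℤ.* p l k ℤ.+ Fᵢ)
        ≡⟨ cong₂ (λ x y → a ℤ.* x ℤ.- r j k ℤ.* y) (∑ℤ-++-∷ ks₁ k ks₂ _) (∑ℤ-++-∷ ks₁ k ks₂ _) ⟨
      a ℤ.* F j l ℤ.- r j k ℤ.* F i l ∎
      where
      open ≡-Reasoning
      Fⱼ Fᵢ : ℤ
      Fⱼ = ∑ℤ[ k′ ∈ ks₁ ++ ks₂ ] (r j k′ ℤ.* p l k′)
      Fᵢ = ∑ℤ[ k′ ∈ ks₁ ++ ks₂ ] (r i k′ ℤ.* p l k′)
      distrib : ∀ a x y z w → (a ℤ.* x ℤ.- y ℤ.* z) ℤ.* w ≡ a ℤ.* (x ℤ.* w) ℤ.- y ℤ.* (z ℤ.* w)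
      distrib = solve-∀
      cancel : ∀ a c q X Y → a ℤ.* X ℤ.- c ℤ.* Y ≡ a ℤ.* (c ℤ.* q ℤ.+ X) ℤ.- c ℤ.* (a ℤ.* q ℤ.+ Y)
      cancel = solve-∀
    F′≡aF : ∀ {j l} → F i l ≡ 0ℤ → F′ j l ≡ a ℤ.* F j l
    F′≡aF {j} {l} Fᵢₗ≡0 =
      trans (eliminate j l) (trans (cong (λ x → a ℤ.* F j l ℤ.- r j k ℤ.* x) Fᵢₗ≡0) (drop a (F j l) (r j k)))
      where
      drop : ∀ x y z → x ℤ.* y ℤ.- z ℤ.* 0ℤ ≡ x ℤ.* y
      drop = solve-∀
    diag′ : All (λ j → F′ j j ≢ 0ℤ) xs
    diag′ = All.zipWith (λ (Fᵢⱼ≡0 , Fⱼⱼ≢0) F′ⱼⱼ≡0 →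
                           [ a≢0 , Fⱼⱼ≢0 ]′ (ℤ.i*j≡0⇒i≡0∨j≡0 a (trans (≡.sym (F′≡aF Fᵢⱼ≡0)) F′ⱼⱼ≡0)))
                        (Fᵢ≡0 , diag)
    pairs′ : AllPairs (λ j l → F′ j l ≡ 0ℤ) xs
    pairs′ = AllPairs-mapWith-All Fᵢ≡0
               (λ _ Fᵢₗ≡0 Fⱼₗ≡0 → trans (F′≡aF Fᵢₗ≡0) (trans (cong (a ℤ.*_) Fⱼₗ≡0) (ℤ.*-zeroʳ a))) pairs

-- Splitting computation paths

module _ {s} (M : NFA s) where

  private
    Q = Fin (states M)
    Qs : List Q
    Qs = allFin (states M)
    ∑Q : (Q → ℕ) → ℕ
    ∑Q = sumℕ Qs

  paths-halting : ∀ t q w → acc M q ∨ rej M q ≡ true → paths M t q w ≡ (if t q then 1 else 0)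
  paths-halting t q w h with acc M q ∨ rej M q
  paths-halting t q w refl | true = refl

  paths-∷ : ∀ t q a w → acc M q ∨ rej M q ≡ false →
            paths M t q (a ∷ w) ≡ ∑Q (λ q' → if δ M q a q' then paths M t q' w else 0)
  paths-∷ t q a w h with acc M q ∨ rej M q
  paths-∷ t q a w refl | false = refl

  reaching : Q → List (TapeSym s) → Q → ℕ
  reaching q []      q' = indicator q q'
  reaching q (a ∷ w) q' with acc M q ∨ rej M q
  ... | true  = 0
  ... | false = ∑Q (λ q'' → if δ M q a q'' then reaching q'' w q' else 0)

  haltingWithin : (Q → Bool) → Q → List (TapeSym s) → ℕ
  haltingWithin t q []      = 0
  haltingWithin t q (a ∷ w) with acc M q ∨ rej M q
  ... | true  = if t q then 1 else 0
  ... | false = ∑Q (λ q'' → if δ M q a q'' then haltingWithin t q'' w else 0)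

  paths-++ : ∀ t q w₁ w₂ →
             paths M t q (w₁ ++ w₂) ≡ haltingWithin t q w₁ + ∑Q (λ q' → reaching q w₁ q' * paths M t q' w₂)
  paths-++ t q []       w₂ = ≡.sym (∑ℕ-allFin-indicator q (λ q' → paths M t q' w₂))
  paths-++ t q (a ∷ w₁) w₂ with acc M q ∨ rej M q
  ... | true  = ≡.sym (trans (cong (_+_ (if t q then 1 else 0)) (∑ℕ-zero Qs (λ _ → refl)))
                             (ℕ.+-identityʳ _))
  ... | false = begin
    ∑Q (λ q'' → [δ] q'' (paths M t q'' (w₁ ++ w₂)))
      ≡⟨ ∑ℕ-cong Qs (λ q'' → cong ([δ] q'') (paths-++ t q'' w₁ w₂)) ⟩
    ∑Q (λ q'' → [δ] q'' (H q'' + R q''))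
      ≡⟨ ∑ℕ-cong Qs (λ q'' → if-+ (δ M q a q'') (H q'') (R q'')) ⟩
    ∑Q (λ q'' → [δ] q'' (H q'') + [δ] q'' (R q''))
      ≡⟨ ∑ℕ-+ Qs _ _ ⟩
    ∑Q (λ q'' → [δ] q'' (H q'')) + ∑Q (λ q'' → [δ] q'' (R q''))
      ≡⟨ cong (_+_ (∑Q (λ q'' → [δ] q'' (H q'')))) reassociate ⟩
    ∑Q (λ q'' → [δ] q'' (H q'')) + ∑Q (λ q' → ∑Q (λ q'' → [δ] q'' (reaching q'' w₁ q')) * paths M t q' w₂) ∎
    where
    open ≡-Reasoning
    [δ] : Q → ℕ → ℕ
    [δ] q'' x = if δ M q a q'' then x else 0
    H R : Q → ℕ
    H q'' = haltingWithin t q'' w₁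
    R q'' = ∑Q (λ q' → reaching q'' w₁ q' * paths M t q' w₂)
    reassociate : ∑Q (λ q'' → [δ] q'' (R q'')) ≡ ∑Q (λ q' → ∑Q (λ q'' → [δ] q'' (reaching q'' w₁ q')) * paths M t q' w₂)
    reassociate = begin
      ∑Q (λ q'' → [δ] q'' (R q''))
        ≡⟨ ∑ℕ-cong Qs (λ q'' → if-∑ℕ (δ M q a q'') Qs _) ⟩
      ∑Q (λ q'' → ∑Q (λ q' → [δ] q'' (reaching q'' w₁ q' * paths M t q' w₂)))
        ≡⟨ ∑ℕ-comm Qs Qs _ ⟩
      ∑Q (λ q' → ∑Q (λ q'' → [δ] q'' (reaching q'' w₁ q' * paths M t q' w₂)))
        ≡⟨ ∑ℕ-cong Qs (λ q' → ∑ℕ-cong Qs (λ q'' → ≡.sym (if-*ʳ (δ M q a q'') (reaching q'' w₁ q') (paths M t q' w₂)))) ⟩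
      ∑Q (λ q' → ∑Q (λ q'' → [δ] q'' (reaching q'' w₁ q') * paths M t q' w₂))
        ≡⟨ ∑ℕ-cong Qs (λ q' → ≡.sym (∑ℕ-*ʳ Qs _ _)) ⟩
      ∑Q (λ q' → ∑Q (λ q'' → [δ] q'' (reaching q'' w₁ q')) * paths M t q' w₂) ∎

cells : ∀ {s} → Str s → List (TapeSym s)
cells x = map sym x ++ rend ∷ []

tape-++ : ∀ {s} (u v : Str s) → tape (u ++ v) ≡ (lend ∷ map sym u) ++ cells v
tape-++ u v = cong (lend ∷_) (trans (cong (_++ rend ∷ []) (map-++ sym u v)) (++-assoc (map sym u) (map sym v) (rend ∷ [])))

module _ {s} (N : NFA s) where

  -- A computation path cut after ▷u is in some state, or has already halted (nothing).
  Cut : Set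
  Cut = Maybe (Fin (states N))

  cuts : List Cut
  cuts = nothing ∷ map just (allFin (states N))

  length-cuts : length cuts ≡ suc (states N)
  length-cuts = cong suc (trans (length-map just (allFin (states N))) (length-tabulate {n = states N} id))

  prefixWeight : (Fin (states N) → Bool) → Str s → Cut → ℕ
  prefixWeight t u nothing  = haltingWithin N t (q₀ N) (lend ∷ map sym u)
  prefixWeight t u (just q) = reaching N (q₀ N) (lend ∷ map sym u) q

  suffixWeight : (Fin (states N) → Bool) → Str s → Cut → ℕ
  suffixWeight t v nothing  = 1
  suffixWeight t v (just q) = paths N t q (cells v)

  paths-tape-++ : ∀ t u v → paths N t (q₀ N) (tape (u ++ v)) ≡ ∑ℕ[ c ∈ cuts ] (prefixWeight t u c * suffixWeight t v c)
  paths-tape-++ t u v = begin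
    paths N t (q₀ N) (tape (u ++ v))
      ≡⟨ cong (paths N t (q₀ N)) (tape-++ u v) ⟩
    paths N t (q₀ N) ((lend ∷ map sym u) ++ cells v)
      ≡⟨ paths-++ N t (q₀ N) (lend ∷ map sym u) (cells v) ⟩
    prefixWeight t u nothing + ∑ℕ[ q ∈ allFin (states N) ] W (just q)
      ≡⟨ cong₂ _+_ (≡.sym (ℕ.*-identityʳ _)) (≡.sym (∑ℕ-map just (allFin (states N)) W)) ⟩
    ∑ℕ[ c ∈ cuts ] W c ∎
    where
    open ≡-Reasoning
    W : Cut → ℕ
    W c = prefixWeight t u c * suffixWeight t v c

  prefixWeightℤ : Str s → Cut → ℤ
  prefixWeightℤ u nothing  = + prefixWeight (acc N) u nothing ℤ.- + prefixWeight (rej N) u nothing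
  prefixWeightℤ u (just q) = + prefixWeight (acc N) u (just q)

  suffixWeightℤ : Str s → Cut → ℤ
  suffixWeightℤ v nothing  = 1ℤ
  suffixWeightℤ v (just q) = + suffixWeight (acc N) v (just q) ℤ.- + suffixWeight (rej N) v (just q)

  gap-++ : ∀ u v → gap N (u ++ v) ≡ ∑ℤ[ c ∈ cuts ] (prefixWeightℤ u c ℤ.* suffixWeightℤ v c)
  gap-++ u v = begin
    + #acc N (u ++ v) ℤ.- + #rej N (u ++ v)
      ≡⟨ cong₂ (λ a r → + a ℤ.- + r) (paths-tape-++ (acc N) u v) (paths-tape-++ (rej N) u v) ⟩
    + sumℕ cuts (W (acc N)) ℤ.- + sumℕ cuts (W (rej N))
      ≡⟨ cong₂ ℤ._-_ (+-∑ℕ cuts (W (acc N))) (+-∑ℕ cuts (W (rej N))) ⟩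
    ∑ℤ[ c ∈ cuts ] (+ W (acc N) c) ℤ.- ∑ℤ[ c ∈ cuts ] (+ W (rej N) c)
      ≡⟨ ≡.sym (∑ℤ-− cuts (λ c → + W (acc N) c) (λ c → + W (rej N) c)) ⟩
    ∑ℤ[ c ∈ cuts ] (+ W (acc N) c ℤ.- + W (rej N) c)
      ≡⟨ ∑ℤ-cong cuts pointwise ⟩
    ∑ℤ[ c ∈ cuts ] (prefixWeightℤ u c ℤ.* suffixWeightℤ v c) ∎
    where
    open ≡-Reasoning
    W : (Fin (states N) → Bool) → Cut → ℕ
    W t c = prefixWeight t u c * suffixWeight t v c
    pointwise : ∀ c → + W (acc N) c ℤ.- + W (rej N) c ≡ prefixWeightℤ u c ℤ.* suffixWeightℤ v c
    pointwise nothing  = trans (cong₂ (λ a r → + a ℤ.- + r) (ℕ.*-identityʳ hA) (ℕ.*-identityʳ hR))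
                               (≡.sym (ℤ.*-identityʳ (+ hA ℤ.- + hR)))
      where
      hA = prefixWeight (acc N) u nothing
      hR = prefixWeight (rej N) u nothing
    pointwise (just q) = trans (cong₂ ℤ._-_ (ℤ.pos-* r a) (ℤ.pos-* r b)) (factor (+ r) (+ a) (+ b))
      where
      r = prefixWeight (acc N) u (just q)
      a = suffixWeight (acc N) v (just q)
      b = suffixWeight (rej N) v (just q)
      factor : ∀ a b c → a ℤ.* b ℤ.- a ℤ.* c ≡ a ℤ.* (b ℤ.- c)
      factor = solve-∀

module _ {s} (N : NFA s) {I : Set} (u v : I → Str s) where

  #acc-fooling-bound : ∀ {xs} → All (λ i → #acc N (u i ++ v i) ≡ 0) xs →
                       AllPairs (λ i j → 0 < #acc N (u i ++ v j)) xs → length xs ≤ 2 ^ suc (states N)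
  #acc-fooling-bound {xs} diag pairs = subst (λ m → length xs ≤ 2 ^ m) (length-cuts N)
    (fooling-bound (cuts N) (λ i → prefixWeight N (acc N) (u i)) (λ j → suffixWeight N (acc N) (v j))
      (All.map (λ {i} → trans (≡.sym (paths-tape-++ N (acc N) (u i) (v i)))) diag)
      (AllPairs.map (λ {i} {j} → subst (0 <_) (paths-tape-++ N (acc N) (u i) (v j))) pairs))

  gap-rank-bound : ∀ {xs} → All (λ i → gap N (u i ++ v i) ≢ 0ℤ) xs →
                   AllPairs (λ i j → gap N (u i ++ v j) ≡ 0ℤ) xs → length xs ≤ suc (states N)
  gap-rank-bound {xs} diag pairs = subst (length xs ≤_) (length-cuts N)
    (rank-bound (cuts N) (λ i → prefixWeightℤ N (u i)) (λ j → suffixWeightℤ N (v j))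
      (All.map (λ {i} gap≢0 → gap≢0 ∘ trans (gap-++ N (u i) (v i))) diag)
      (AllPairs.map (λ {i} {j} → trans (≡.sym (gap-++ N (u i) (v j)))) pairs))

-- Polynomials against exponentials

evalPoly≤ : ∀ cs n → sum cs ≤ n → evalPoly cs n ≤ suc n ^ suc (length cs)
evalPoly≤ []       n _  = z≤n
evalPoly≤ (c ∷ cs) n Σ≤n = begin
  c + n * evalPoly cs n ≤⟨ ℕ.+-mono-≤ c≤n (ℕ.*-monoʳ-≤ n (evalPoly≤ cs n (ℕ.≤-trans (ℕ.m≤n+m (sum cs) c) Σ≤n))) ⟩
  n + n * X             ≤⟨ ℕ.+-monoˡ-≤ (n * X) (ℕ.≤-trans (ℕ.n≤1+n n) (ℕ.m≤m*n (suc n) Y {{ℕ.m^n≢0 (suc n) (length cs)}})) ⟩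
  X + n * X             ∎
  where
  open ℕ.≤-Reasoning
  X Y : ℕ
  Y = suc n ^ length cs
  X = suc n * Y
  c≤n : c ≤ n
  c≤n = ℕ.≤-trans (ℕ.m≤m+n c (sum cs)) Σ≤n

square≤2^ : ∀ k → (4 + k) * (4 + k) ≤ 2 ^ (4 + k)
square≤2^ zero    = ℕ.≤-refl
square≤2^ (suc k) = begin
  (5 + k) * (5 + k)         ≡⟨ expand k ⟩
  S + (9 + 2 * k)           ≤⟨ ℕ.+-monoʳ-≤ S (ℕ.≤-trans (ℕ.m≤m+n _ _) (ℕ.≤-reflexive (≡.sym (expand′ k)))) ⟩
  S + S                     ≤⟨ ℕ.+-mono-≤ (square≤2^ k) (square≤2^ k) ⟩
  2 ^ (4 + k) + 2 ^ (4 + k) ≡⟨ cong (_+_ (2 ^ (4 + k))) (ℕ.+-identityʳ _) ⟨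
  2 ^ (5 + k)               ∎
  where
  open ℕ.≤-Reasoning
  S = (4 + k) * (4 + k)
  expand : ∀ k → (5 + k) * (5 + k) ≡ (4 + k) * (4 + k) + (9 + 2 * k)
  expand = ℕ-Solver.solve-∀
  expand′ : ∀ k → (4 + k) * (4 + k) ≡ 9 + 2 * k + (7 + 6 * k + k * k)
  expand′ = ℕ-Solver.solve-∀

2+2^≤2^2+ : ∀ e → 2 + 2 ^ e ≤ 2 ^ (2 + e)
2+2^≤2^2+ e = begin
  2 + 2 ^ e         ≤⟨ ℕ.+-monoˡ-≤ (2 ^ e) (ℕ.≤-trans (ℕ.n≤1+n 2) (ℕ.*-monoʳ-≤ 3 (ℕ.m^n>0 2 e))) ⟩
  3 * 2 ^ e + 2 ^ e ≡⟨ quadruple (2 ^ e) ⟩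
  2 ^ (2 + e)       ∎
  where
  open ℕ.≤-Reasoning
  quadruple : ∀ x → 3 * x + x ≡ 2 * (2 * x)
  quadruple = ℕ-Solver.solve-∀

2^-dominates-evalPoly : ∀ cs → ∃ λ n → 2 + evalPoly cs n ≤ 2 ^ n
2^-dominates-evalPoly cs = n , (begin
  2 + evalPoly cs n   ≤⟨ ℕ.+-monoʳ-≤ 2 (evalPoly≤ cs n c≤n) ⟩
  2 + suc n ^ D       ≤⟨ ℕ.+-monoʳ-≤ 2 (ℕ.^-monoˡ-≤ D 1+n≤2^1+t) ⟩
  2 + (2 ^ suc t) ^ D ≡⟨ cong (_+_ 2) (ℕ.^-*-assoc 2 (suc t) D) ⟩
  2 + 2 ^ (suc t * D) ≤⟨ 2+2^≤2^2+ (suc t * D) ⟩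
  2 ^ (2 + suc t * D) ≤⟨ ℕ.^-monoʳ-≤ 2 exponent≤n ⟩
  2 ^ n               ∎)
  where
  open ℕ.≤-Reasoning
  c d t n D : ℕ
  c = sum cs
  d = length cs
  D = suc d
  t = 4 + (c + d)
  n = 2 ^ t
  t*t≤n : t * t ≤ n
  t*t≤n = square≤2^ (c + d)
  t≤n : t ≤ n
  t≤n = ℕ.≤-trans (ℕ.m≤m*n t t) t*t≤n
  c≤n : c ≤ n
  c≤n = ℕ.≤-trans (ℕ.≤-trans (ℕ.m≤m+n c d) (ℕ.m≤n+m (c + d) 4)) t≤n
  1+n≤2^1+t : suc n ≤ 2 ^ suc t
  1+n≤2^1+t = ℕ.≤-trans (ℕ.+-monoˡ-≤ n (ℕ.m^n>0 2 t)) (ℕ.≤-reflexive (cong (_+_ n) (≡.sym (ℕ.+-identityʳ n))))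
  3+d≤t : 3 + d ≤ t
  3+d≤t = ℕ.≤-trans (ℕ.m≤m+n (3 + d) (suc c)) (ℕ.≤-reflexive (shuffle c d))
    where
    shuffle : ∀ c d → 3 + d + suc c ≡ 4 + (c + d)
    shuffle = ℕ-Solver.solve-∀
  exponent≤n : 2 + suc t * D ≤ n
  exponent≤n = begin
    2 + suc t * suc d   ≡⟨ expand t d ⟩
    t * suc d + (3 + d) ≤⟨ ℕ.+-monoʳ-≤ (t * suc d) 3+d≤t ⟩
    t * suc d + t       ≡⟨ ℕ.+-comm (t * suc d) t ⟩
    t + t * suc d       ≡⟨ ℕ.*-suc t (suc d) ⟨
    t * (2 + d)         ≤⟨ ℕ.*-monoʳ-≤ t (ℕ.≤-trans (ℕ.n≤1+n (2 + d)) 3+d≤t) ⟩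
    t * t               ≤⟨ t*t≤n ⟩
    n                   ∎
    where
    expand : ∀ t d → 2 + suc t * suc d ≡ t * suc d + (3 + d)
    expand = ℕ-Solver.solve-∀

-- 1N ⊆ co-1C=

paths-unreachable : ∀ {s} (M : NFA s) q w → paths M (λ _ → false) q w ≡ 0
paths-unreachable M q w with acc M q ∨ rej M q
paths-unreachable M q w       | true  = refl
paths-unreachable M q []      | false = refl
paths-unreachable M q (a ∷ w) | false =
  ∑ℕ-zero (allFin (states M)) (λ q' → if-zero (δ M q a q') (paths-unreachable M q' w))
  where
  if-zero : ∀ b {x} → x ≡ 0 → (if b then x else 0) ≡ 0
  if-zero true  x≡0 = x≡0
  if-zero false _   = refl

dropRejection : ∀ {s} → NFA s → NFA s
dropRejection M = record
  { states = states M
  ; δ      = λ q a q' → not (rej M q) ∧ δ M q a q'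
  ; q₀     = q₀ M
  ; acc    = acc M
  ; rej    = λ _ → false
  ; disj   = λ _ _ → refl
  }

paths-dropRejection : ∀ {s} (M : NFA s) q w → paths (dropRejection M) (acc M) q w ≡ paths M (acc M) q w
paths-dropRejection M q w with acc M q in isAcc | rej M q in isRej
paths-dropRejection M q w       | true  | _     = refl
paths-dropRejection M q []      | false | true  = cong (if_then 1 else 0) (≡.sym isAcc)
paths-dropRejection M q (a ∷ w) | false | true  =
  trans (∑ℕ-zero (allFin (states M))
           (λ q' → cong (λ b → if not b ∧ δ M q a q' then paths (dropRejection M) (acc M) q' w else 0) isRej))
        (cong (if_then 1 else 0) (≡.sym isAcc))
paths-dropRejection M q []      | false | false = refl
paths-dropRejection M q (a ∷ w) | false | false =
  ∑ℕ-cong (allFin (states M)) (λ q' → cong₂ (λ b x → if not b ∧ δ M q a q' then x else 0) isRej (paths-dropRejection M q' w))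

gap-dropRejection : ∀ {s} (M : NFA s) x → gap (dropRejection M) x ≡ + #acc M x
gap-dropRejection M x
  rewrite paths-unreachable (dropRejection M) (q₀ M) (tape x) | paths-dropRejection M (q₀ M) (tape x) =
  ℤ.+-identityʳ (+ #acc M x)

OneN⊆coOneCeq : OneN ⊆C coC OneCeq
OneN⊆coOneCeq L (F , (M , poly , F≡#acc) , pos , neg) =
  G , ((λ n → dropRejection (M n)) , poly , G≡gap) ,
  (λ n x x∈L⁻ → let (d , f≡0) = neg n x x∈L⁻ in d , cong +_ f≡0) ,
  (λ n x x∈L⁺ → let (d , 0<f) = pos n x x∈L⁺ in d , λ +f≡0 → ℕ.<⇒≢ 0<f (≡.sym (ℤ.+-injective +f≡0)))
  where
  G : PartialFamily _ ℤ
  G = record { Dom = Dom F ; fun = λ n x d → + fun F n x d }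
  G≡gap : ∀ n x d → fun G n x d ≡ gap (dropRejection (M n)) x
  G≡gap n x d = trans (cong +_ (F≡#acc n x d)) (≡.sym (gap-dropRejection (M n) x))

-- Unbalanced counts of 0 and 1

count : ∀ {s} → Fin s → Str s → ℕ
count b []      = 0
count b (c ∷ x) = indicator b c + count b x

Unbalanced : PromiseFamily 2
Unbalanced = record
  { Lpos     = λ _ x → count zero x ≢ count (suc zero) x
  ; Lneg     = λ _ x → count zero x ≡ count (suc zero) x
  ; disjoint = λ _ _ x∈L⁺ x∈L⁻ → x∈L⁺ x∈L⁻
  }

-- Every 0 (resp. 1) read in the scanning state 1 spawns a path that halts at once in the
-- accepting state 2 (resp. the rejecting state 3).
countingDifference : NFA 2
countingDifference = record { states = 4 ; δ = step ; q₀ = zero ; acc = accepting ; rej = rejecting ; disj = accepting⇒¬rejecting }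
  where
  step : Fin 4 → TapeSym 2 → Fin 4 → Bool
  step zero             lend             (suc zero)                   = true
  step (suc zero)       (sym _)          (suc zero)                   = true
  step (suc zero)       (sym zero)       (suc (suc zero))             = true
  step (suc zero)       (sym (suc zero)) (suc (suc (suc zero)))       = true
  step _                _                _                            = false
  accepting rejecting : Fin 4 → Bool
  accepting q = does (q Fin.≟ suc (suc zero))
  rejecting q = does (q Fin.≟ suc (suc (suc zero)))
  accepting⇒¬rejecting : ∀ q → accepting q ≡ true → rejecting q ≡ false
  accepting⇒¬rejecting (suc (suc zero)) _ = refl

gap-countingDifference : ∀ x → gap countingDifference x ≡ + count zero x ℤ.- + count (suc zero) x
gap-countingDifference x = cong₂ (λ a r → + a ℤ.- + r) (trans (ℕ.+-identityʳ _) (accepting x))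
                                                       (trans (ℕ.+-identityʳ _) (rejecting x))
  where
  D = countingDifference
  scanning : Fin 4
  scanning = suc zero
  accepting : ∀ x → paths D (acc D) scanning (cells x) ≡ count zero x
  accepting []             = refl
  accepting (zero ∷ x)     = trans (ℕ.+-comm (paths D (acc D) scanning (cells x)) 1) (cong suc (accepting x))
  accepting (suc zero ∷ x) = trans (ℕ.+-identityʳ _) (accepting x)
  rejecting : ∀ x → paths D (rej D) scanning (cells x) ≡ count (suc zero) x
  rejecting []             = refl
  rejecting (zero ∷ x)     = trans (ℕ.+-identityʳ _) (rejecting x)
  rejecting (suc zero ∷ x) = trans (ℕ.+-comm (paths D (rej D) scanning (cells x)) 1) (cong suc (rejecting x))

coUnbalanced∈OneCeq : OneCeq (co Unbalanced)
coUnbalanced∈OneCeq =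
  F , ((λ _ → countingDifference) , (4 ∷ [] , λ n → ℕ.m≤m+n 4 (n * 0)) , λ _ _ _ → refl) ,
  (λ _ x balanced → tt , trans (gap-countingDifference x) (trans (cong (λ c → + c ℤ.- + count (suc zero) x) balanced)
                                                               (ℤ.+-inverseʳ (+ count (suc zero) x)))) ,
  (λ _ x unbalanced → tt , λ gap≡0 →
     unbalanced (ℤ.+-injective (ℤ.i-j≡0⇒i≡j _ _ (trans (≡.sym (gap-countingDifference x)) gap≡0))))
  where
  F : PartialFamily 2 ℤ
  F = record { Dom = λ _ _ → ⊤ ; fun = λ _ x _ → gap countingDifference x }

Unbalanced∉OneN : ¬ OneN Unbalanced
Unbalanced∉OneN (F , (M , _ , F≡#acc) , pos , neg) =
  ℕ.<-irrefl refl (subst (_≤ 2 ^ suc (states N)) (length-upTo m) (#acc-fooling-bound N zeros ones diag pairs))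
  where
  N = M 0
  m = suc (2 ^ suc (states N))
  zeros ones : ℕ → Str 2
  zeros i = replicate i zero
  ones  j = replicate j (suc zero)
  count-zeros : ∀ i j → count zero (zeros i ++ ones j) ≡ i
  count-zeros (suc i) j       = cong suc (count-zeros i j)
  count-zeros zero    zero    = refl
  count-zeros zero    (suc j) = count-zeros zero j
  count-ones : ∀ i j → count (suc zero) (zeros i ++ ones j) ≡ j
  count-ones (suc i) j       = count-ones i j
  count-ones zero    zero    = refl
  count-ones zero    (suc j) = cong suc (count-ones zero j)
  diag : All (λ i → #acc N (zeros i ++ ones i) ≡ 0) (upTo m)
  diag = All.universal (λ i → let (d , f≡0) = neg 0 _ (trans (count-zeros i i) (≡.sym (count-ones i i)))
                              in trans (≡.sym (F≡#acc 0 _ d)) f≡0) (upTo m)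
  pairs : AllPairs (λ i j → 0 < #acc N (zeros i ++ ones j)) (upTo m)
  pairs = AllPairs.map (λ {i} {j} i≢j →
                          let (d , 0<f) = pos 0 _ (λ eq → i≢j (trans (≡.sym (count-zeros i j)) (trans eq (count-ones i j))))
                          in subst (0 <_) (F≡#acc 0 _ d) 0<f)
                       (UniqueP.upTo⁺ m)

record Enumeration (A : Set) : Set where
  field
    size          : ℕ
    encode        : A → Fin size
    decode        : Fin size → A
    decode-encode : ∀ a → decode (encode a) ≡ a

open Enumeration

-- On ▷ only the start state moves (to the states in initial); no state moves on ◁.
module Presented {Q L : Set} (enumQ : Enumeration Q) (enumL : Enumeration L)
                 (start : Q) (initial : List Q) (next : Q → L → List Q) (accepting : Q → Bool) where

  private
    _∈ᵇ_ : Fin (size enumQ) → List Q → Bool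
    q ∈ᵇ ts = does (any? (λ t → encode enumQ t Fin.≟ q) ts)

    step : Fin (size enumQ) → TapeSym (size enumL) → Fin (size enumQ) → Bool
    step q lend    q' = does (q Fin.≟ encode enumQ start) ∧ (q' ∈ᵇ initial)
    step q rend    q' = false
    step q (sym c) q' = q' ∈ᵇ next (decode enumQ q) (decode enumL c)

  automaton : NFA (size enumL)
  automaton = record
    { states = size enumQ ; δ = step ; q₀ = encode enumQ start
    ; acc = accepting ∘ decode enumQ ; rej = λ _ → false ; disj = λ _ _ → refl }

  run : Q → List (TapeSym (size enumL)) → ℕ
  run q = paths automaton (acc automaton) (encode enumQ q)

  private
    from : List Q → List (TapeSym (size enumL)) → ℕ
    from ts w = ∑ℕ[ q' ∈ allFin (size enumQ) ] (if q' ∈ᵇ ts then paths automaton (acc automaton) q' w else 0)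

    from-zero : ∀ ts w → (∀ {t} → t ∈ ts → run t w ≡ 0) → from ts w ≡ 0
    from-zero ts w runs≡0 = ∑ℕ-zero (allFin (size enumQ)) term≡0
      where
      term≡0 : ∀ q' → (if q' ∈ᵇ ts then paths automaton (acc automaton) q' w else 0) ≡ 0
      term≡0 q' with any? (λ t → encode enumQ t Fin.≟ q') ts
      ... | no  _     = refl
      ... | yes q'∈ts with find q'∈ts
      ...   | t , t∈ts , refl = runs≡0 t∈ts

    from-pos : ∀ {t} ts w → t ∈ ts → 0 < run t w → 0 < from ts w
    from-pos {t} ts w t∈ts 0<run = ℕ.<-≤-trans (subst (λ b → 0 < (if b then run t w else 0)) (≡.sym chosen) 0<run)
      (∈⇒≤∑ℕ (λ q' → if q' ∈ᵇ ts then paths automaton (acc automaton) q' w else 0) (∈-allFin (encode enumQ t)))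
      where
      chosen : encode enumQ t ∈ᵇ ts ≡ true
      chosen = dec-true (any? (λ t' → encode enumQ t' Fin.≟ encode enumQ t) ts) (lose t∈ts refl)

    live : ∀ {q} → accepting q ≡ false → acc automaton (encode enumQ q) ∨ false ≡ false
    live {q} q-live = cong (_∨ false) (trans (cong accepting (decode-encode enumQ q)) q-live)

    run-letter : ∀ {q} l w → accepting q ≡ false → run q (sym (encode enumL l) ∷ w) ≡ from (next q l) w
    run-letter {q} l w q-live = trans (paths-∷ automaton _ (encode enumQ q) _ w (live q-live))
                                      (cong (λ ts → from ts w) (cong₂ next (decode-encode enumQ q) (decode-encode enumL l)))

    run-start : ∀ w → accepting start ≡ false → run start (lend ∷ w) ≡ from initial w
    run-start w start-live =
      trans (paths-∷ automaton _ (encode enumQ start) _ w (live start-live))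
            (cong (λ b → ∑ℕ[ q' ∈ allFin (size enumQ) ] (if b ∧ (q' ∈ᵇ initial) then paths automaton (acc automaton) q' w else 0))
                  (dec-true (encode enumQ start Fin.≟ encode enumQ start) refl))

  run-accepting : ∀ {q} w → accepting q ≡ true → run q w ≡ 1
  run-accepting {q} w q-acc = trans (paths-halting automaton _ (encode enumQ q) w (cong (_∨ false) acc≡true))
                                    (cong (if_then 1 else 0) acc≡true)
    where
    acc≡true : acc automaton (encode enumQ q) ≡ true
    acc≡true = trans (cong accepting (decode-encode enumQ q)) q-acc

  run-letter-zero : ∀ {q} l w → accepting q ≡ false → (∀ {t} → t ∈ next q l → run t w ≡ 0) →
                    run q (sym (encode enumL l) ∷ w) ≡ 0
  run-letter-zero l w q-live runs≡0 = trans (run-letter l w q-live) (from-zero _ w runs≡0)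

  run-letter-pos : ∀ {q t} l w → accepting q ≡ false → t ∈ next q l → 0 < run t w → 0 < run q (sym (encode enumL l) ∷ w)
  run-letter-pos l w q-live t∈next 0<run = subst (0 <_) (≡.sym (run-letter l w q-live)) (from-pos _ w t∈next 0<run)

  run-start-zero : ∀ w → accepting start ≡ false → (∀ {t} → t ∈ initial → run t w ≡ 0) → run start (lend ∷ w) ≡ 0
  run-start-zero w start-live runs≡0 = trans (run-start w start-live) (from-zero initial w runs≡0)

  run-start-pos : ∀ {t} w → accepting start ≡ false → t ∈ initial → 0 < run t w → 0 < run start (lend ∷ w)
  run-start-pos w start-live t∈initial 0<run = subst (0 <_) (≡.sym (run-start w start-live)) (from-pos initial w t∈initial 0<run)

-- Inequality of bit strings

data Letter : Set where
  bit  : Bool → Letter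
  hash : Letter

letters : Enumeration Letter
letters = record { size = 3 ; encode = encodeLetter ; decode = decodeLetter ; decode-encode = decode-encodeLetter }
  where
  encodeLetter : Letter → Fin 3
  encodeLetter (bit false) = zero
  encodeLetter (bit true)  = suc zero
  encodeLetter hash        = suc (suc zero)
  decodeLetter : Fin 3 → Letter
  decodeLetter zero             = bit false
  decodeLetter (suc zero)       = bit true
  decodeLetter (suc (suc zero)) = hash
  decode-encodeLetter : ∀ l → decodeLetter (encodeLetter l) ≡ l
  decode-encodeLetter (bit false) = refl
  decode-encodeLetter (bit true)  = refl
  decode-encodeLetter hash        = refl

hashSym : Fin 3
hashSym = encode letters hash

bits : List Bool → Str 3
bits = map (encode letters ∘ bit)

pairing : List Bool → List Bool → Str 3
pairing u v = bits u ++ hashSym ∷ bits (reverse v)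

data State (n : ℕ) : Set where
  start scan accept : State n
  carry check       : Bool → Fin n → State n

stateCount : ℕ → ℕ
stateCount n = 3 + ((n + n) + (n + n))

stateEnum : ∀ n → Enumeration (State n)
stateEnum n = record { size = stateCount n ; encode = encodeState ; decode = decodeState ; decode-encode = decode-encodeState }
  where
  tag : Bool → Fin n → Fin n ⊎ Fin n
  tag false = inj₁
  tag true  = inj₂
  untag : Fin n ⊎ Fin n → Bool × Fin n
  untag = [ (false ,_) , (true ,_) ]′
  untag-tag : ∀ b k → untag (tag b k) ≡ (b , k)
  untag-tag false k = refl
  untag-tag true  k = refl
  encodeState : State n → Fin (stateCount n)
  encodeState start       = zero
  encodeState scan        = suc zero
  encodeState accept      = suc (suc zero)
  encodeState (carry b k) = suc (suc (suc (Fin.join (n + n) (n + n) (inj₁ (Fin.join n n (tag b k))))))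
  encodeState (check b k) = suc (suc (suc (Fin.join (n + n) (n + n) (inj₂ (Fin.join n n (tag b k))))))
  decodeState : Fin (stateCount n) → State n
  decodeState zero                   = start
  decodeState (suc zero)             = scan
  decodeState (suc (suc zero))       = accept
  decodeState (suc (suc (suc i)))    =
    [ uncurry carry ∘ untag ∘ Fin.splitAt n , uncurry check ∘ untag ∘ Fin.splitAt n ]′ (Fin.splitAt (n + n) i)
  decode-encodeState : ∀ q → decodeState (encodeState q) ≡ q
  decode-encodeState start       = refl
  decode-encodeState scan        = refl
  decode-encodeState accept      = refl
  decode-encodeState (carry b k)
    rewrite FinP.splitAt-join (n + n) (n + n) (inj₁ (Fin.join n n (tag b k))) | FinP.splitAt-join n n (tag b k)
          | untag-tag b k = refl
  decode-encodeState (check b k)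
    rewrite FinP.splitAt-join (n + n) (n + n) (inj₂ (Fin.join n n (tag b k))) | FinP.splitAt-join n n (tag b k)
          | untag-tag b k = refl

counters : ∀ {n} {P : Fin n → Set} → U.Decidable P → List (Fin n)
counters {n} P? = filter P? (allFin n)

∈-counters⁻ : ∀ {n} {P : Fin n → Set} (P? : U.Decidable P) (f : Fin n → A) {t} →
              t ∈ map f (counters P?) → ∃ λ k → P k × t ≡ f k
∈-counters⁻ P? f t∈ with k , k∈ , refl ← ∈-map⁻ f t∈ = k , proj₂ (∈-filter⁻ P? {xs = allFin _} k∈) , refl

∈-counters⁺ : ∀ {n} {P : Fin n → Set} (P? : U.Decidable P) (f : Fin n → A) {k} → P k → f k ∈ map f (counters P?)
∈-counters⁺ P? f {k} Pk = ∈-map⁺ f (∈-filter⁺ P? (∈-allFin k) Pk)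

zeroCounter : ∀ {n} → List (Fin n)
zeroCounter = counters (λ k → toℕ k ℕ.≟ 0)

incremented decremented : ∀ {n} → Fin n → List (Fin n)
incremented k = counters (λ k' → toℕ k' ℕ.≟ suc (toℕ k))
decremented k = counters (λ k' → toℕ k ℕ.≟ suc (toℕ k'))

acceptIf : ∀ {n} {P : Set} → Dec P → List (State n)
acceptIf (yes _) = accept ∷ []
acceptIf (no  _) = []

∈-acceptIf⁻ : ∀ {n} {P : Set} (P? : Dec P) {t : State n} → t ∈ acceptIf P? → P
∈-acceptIf⁻ (yes p) _ = p

∈-acceptIf⁺ : ∀ {n} {P : Set} (P? : Dec P) → P → accept {n} ∈ acceptIf P?
∈-acceptIf⁺ (yes _) _ = here refl
∈-acceptIf⁺ (no ¬p) p = ⊥-elim (¬p p)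

-- Guess a position of u holding some bit b; count the k symbols of u after it (carry b k),
-- then count down k symbols of vᴿ (check b k) and accept if the next symbol differs from b.
transitions : ∀ {n} → State n → Letter → List (State n)
transitions scan        (bit x) = scan ∷ map (carry x) zeroCounter
transitions (carry b k) (bit _) = map (carry b) (incremented k)
transitions (carry b k) hash    = check b k ∷ []
transitions (check b k) (bit x) = map (check b) (decremented k) ++ acceptIf (toℕ k ℕ.≟ 0 ×-dec ¬? (x Bool.≟ b))
transitions _           _       = []

isAccept : ∀ {n} → State n → Bool
isAccept accept = true
isAccept _      = false

module Guess (n : ℕ) where
  open Presented (stateEnum n) letters start (scan ∷ []) transitions isAccept public

  check-zero : ∀ {b} {k : Fin n} a z → length a ≡ toℕ k → run (check b k) (cells (bits (a ++ b ∷ z))) ≡ 0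
  check-zero {b} {k} [] z len = run-letter-zero {check b k} (bit b) _ refl dead
    where
    dead : ∀ {t} → t ∈ transitions (check b k) (bit b) → run t (cells (bits z)) ≡ 0
    dead t∈ with ∈-++⁻ (map (check b) (decremented k)) t∈
    ... | inj₁ t∈counters with _ , k≡suc , _ ← ∈-counters⁻ _ (check b) t∈counters = ⊥-elim (ℕ.0≢1+n (trans len k≡suc))
    ... | inj₂ t∈accept   = ⊥-elim (proj₂ (∈-acceptIf⁻ (toℕ k ℕ.≟ 0 ×-dec ¬? (b Bool.≟ b)) t∈accept) refl)
  check-zero {b} {k} (x ∷ a) z len = run-letter-zero {check b k} (bit x) _ refl dead
    where
    dead : ∀ {t} → t ∈ transitions (check b k) (bit x) → run t (cells (bits (a ++ b ∷ z))) ≡ 0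
    dead t∈ with ∈-++⁻ (map (check b) (decremented k)) t∈
    ... | inj₁ t∈counters with _ , k≡suc , refl ← ∈-counters⁻ _ (check b) t∈counters =
      check-zero a z (ℕ.suc-injective (trans len k≡suc))
    ... | inj₂ t∈accept   =
      ⊥-elim (ℕ.1+n≢0 (trans len (proj₁ (∈-acceptIf⁻ (toℕ k ℕ.≟ 0 ×-dec ¬? (x Bool.≟ b)) t∈accept))))

  carry-zero : ∀ {b} {k : Fin n} u a z → length a ≡ toℕ k + length u →
               run (carry b k) (cells (bits u ++ hashSym ∷ bits (a ++ b ∷ z))) ≡ 0
  carry-zero {b} {k} []      a z len =
    run-letter-zero {carry b k} hash _ refl λ { (here refl) → check-zero a z (trans len (ℕ.+-identityʳ _)) }
  carry-zero {b} {k} (x ∷ u) a z len = run-letter-zero {carry b k} (bit x) _ refl dead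
    where
    dead : ∀ {t} → t ∈ transitions (carry b k) (bit x) → run t (cells (bits u ++ hashSym ∷ bits (a ++ b ∷ z))) ≡ 0
    dead t∈ with _ , k'≡suc , refl ← ∈-counters⁻ _ (carry b) t∈ =
      carry-zero u a z (trans len (trans (ℕ.+-suc (toℕ k) (length u)) (cong (_+ length u) (≡.sym k'≡suc))))

  scan-zero : ∀ u z → run scan (cells (bits u ++ hashSym ∷ bits (u ʳ++ z))) ≡ 0
  scan-zero []      z = run-letter-zero {scan} hash (cells (bits z)) refl (λ {_} ())
  scan-zero (x ∷ u) z = run-letter-zero {scan} (bit x) _ refl dead
    where
    dead : ∀ {t} → t ∈ transitions scan (bit x) → run t (cells (bits u ++ hashSym ∷ bits (u ʳ++ x ∷ z))) ≡ 0
    dead (here refl) = scan-zero u (x ∷ z)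
    dead (there t∈) with k , k≡0 , refl ← ∈-counters⁻ _ (carry x) t∈ =
      subst (λ w → run (carry x k) (cells (bits u ++ hashSym ∷ bits w)) ≡ 0) (≡.sym (ʳ++-defn u {x ∷ z}))
            (carry-zero u (reverse u) z (trans (length-reverse u) (cong (_+ length u) (≡.sym k≡0))))

  start-zero : ∀ u → #acc automaton (pairing u u) ≡ 0
  start-zero u = run-start-zero _ refl λ { (here refl) → scan-zero u [] }

  private
    counter : ∀ m → m < n → ∃ λ (k : Fin n) → toℕ k ≡ m
    counter m m<n = Fin.fromℕ< m<n , FinP.toℕ-fromℕ< m<n

  check-pos : ∀ {b} {k : Fin n} w y z → toℕ k ≡ length w → y ≢ b → 0 < run (check b k) (cells (bits (w ++ y ∷ z)))
  check-pos {b} {k} []      y z k≡0 y≢b =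
    run-letter-pos {check b k} {accept} (bit y) (cells (bits z)) refl
      (∈-++⁺ʳ (map (check b) (decremented k)) (∈-acceptIf⁺ (toℕ k ℕ.≟ 0 ×-dec ¬? (y Bool.≟ b)) (k≡0 , y≢b)))
      (subst (0 <_) (≡.sym (run-accepting {accept} (cells (bits z)) refl)) (s≤s z≤n))
  check-pos {b} {k} (x ∷ w) y z k≡ y≢b
    with k' , k'≡ ← counter (length w) (ℕ.<-trans (ℕ.n<1+n (length w)) (subst (_< n) k≡ (FinP.toℕ<n k))) =
    run-letter-pos {check b k} {check b k'} (bit x) _ refl
      (∈-++⁺ˡ (∈-counters⁺ _ (check b) (trans k≡ (cong suc (≡.sym k'≡)))))
      (check-pos w y z k'≡ y≢b)

  carry-pos : ∀ {b} {k : Fin n} u w y z → toℕ k + length u ≡ length w → toℕ k + length u < n → y ≢ b →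
              0 < run (carry b k) (cells (bits u ++ hashSym ∷ bits (w ++ y ∷ z)))
  carry-pos {b} {k} []      w y z len _ y≢b =
    run-letter-pos {carry b k} {check b k} hash _ refl (here refl) (check-pos w y z (trans (≡.sym (ℕ.+-identityʳ _)) len) y≢b)
  carry-pos {b} {k} (x ∷ u) w y z len bound y≢b
    with k' , k'≡ ← counter (suc (toℕ k)) (ℕ.≤-<-trans (ℕ.m<m+n (toℕ k) (s≤s z≤n)) bound) =
    run-letter-pos {carry b k} {carry b k'} (bit x) _ refl (∈-counters⁺ _ (carry b) k'≡)
      (carry-pos u w y z (trans shift len) (subst (_< n) (≡.sym shift) bound) y≢b)
    where
    shift : toℕ k' + length u ≡ toℕ k + suc (length u)
    shift = trans (cong (_+ length u) k'≡) (≡.sym (ℕ.+-suc (toℕ k) (length u)))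

  scan-pos : ∀ a x u w y z → length u ≡ length w → length u < n → y ≢ x →
             0 < run scan (cells (bits (a ++ x ∷ u) ++ hashSym ∷ bits (w ++ y ∷ z)))
  scan-pos (c ∷ a) x u w y z len bound y≢x =
    run-letter-pos {scan} {scan} (bit c) _ refl (here refl) (scan-pos a x u w y z len bound y≢x)
  scan-pos []      x u w y z len bound y≢x with k , k≡0 ← counter 0 (ℕ.≤-<-trans z≤n bound) =
    run-letter-pos {scan} {carry x k} (bit x) _ refl (there (∈-counters⁺ _ (carry x) k≡0))
      (carry-pos u w y z (trans (cong (_+ length u) k≡0) len) (subst (_< n) (cong (_+ length u) (≡.sym k≡0)) bound) y≢x)

  start-pos : ∀ a x u y v → length u ≡ length v → length u < n → y ≢ x →
              0 < #acc automaton (pairing (a ++ x ∷ u) (a ++ y ∷ v))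
  start-pos a x u y v len bound y≢x =
    run-start-pos _ refl (here refl)
      (subst (λ w → 0 < run scan (cells (bits (a ++ x ∷ u) ++ hashSym ∷ bits w))) (≡.sym reverse-split)
             (scan-pos a x u (reverse v) y (reverse a) (trans len (≡.sym (length-reverse v))) bound y≢x))
    where
    open ≡-Reasoning
    reverse-split : reverse (a ++ y ∷ v) ≡ reverse v ++ y ∷ reverse a
    reverse-split = begin
      reverse (a ++ y ∷ v)         ≡⟨ reverse-++ a (y ∷ v) ⟩
      reverse (y ∷ v) ++ reverse a ≡⟨ ʳ++-defn (y ∷ v) ⟨
      v ʳ++ (y ∷ reverse a)        ≡⟨ ʳ++-defn v ⟩
      reverse v ++ y ∷ reverse a   ∎

first-difference : ∀ (u v : List Bool) → length u ≡ length v → u ≢ v →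
                   ∃ λ a → ∃ λ x → ∃ λ u′ → ∃ λ y → ∃ λ v′ →
                   u ≡ a ++ x ∷ u′ × v ≡ a ++ y ∷ v′ × y ≢ x × length u′ ≡ length v′
first-difference []      []      _   u≢v = ⊥-elim (u≢v refl)
first-difference (x ∷ u) (y ∷ v) len u≢v with x Bool.≟ y
... | no  x≢y  = [] , x , u , y , v , refl , refl , x≢y ∘ ≡.sym , ℕ.suc-injective len
... | yes refl
  with a , x′ , u′ , y′ , v′ , refl , refl , y′≢x′ , len′ ← first-difference u v (ℕ.suc-injective len) (u≢v ∘ cong (x ∷_))
  = x ∷ a , x′ , u′ , y′ , v′ , refl , refl , y′≢x′ , len′

encode-bit-injective : ∀ {x x′} → encode letters (bit x) ≡ encode letters (bit x′) → x ≡ x′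
encode-bit-injective {false} {false} _ = refl
encode-bit-injective {true}  {true}  _ = refl

bits-hash-injective : ∀ u u′ (w w′ : Str 3) → bits u ++ hashSym ∷ w ≡ bits u′ ++ hashSym ∷ w′ → u ≡ u′ × w ≡ w′
bits-hash-injective []          []           w w′ eq = refl , ∷-injectiveʳ eq
bits-hash-injective []          (true  ∷ u′) w w′ ()
bits-hash-injective []          (false ∷ u′) w w′ ()
bits-hash-injective (true  ∷ u) []           w w′ ()
bits-hash-injective (false ∷ u) []           w w′ ()
bits-hash-injective (x ∷ u)     (x′ ∷ u′)    w w′ eq with bits-hash-injective u u′ w w′ (∷-injectiveʳ eq)
... | refl , w≡w′ = cong (_∷ u) (encode-bit-injective (∷-injectiveˡ eq)) , w≡w′

pairing-injective : ∀ {u v u′ v′} → pairing u v ≡ pairing u′ v′ → u ≡ u′ × v ≡ v′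
pairing-injective {u} {v} {u′} {v′} eq with bits-hash-injective u u′ _ _ eq
... | u≡u′ , w≡w′ = u≡u′ , reverse-injective (map-injective encode-bit-injective w≡w′)

Inequality : PromiseFamily 3
Inequality = record
  { Lpos     = λ n x → ∃ λ u → ∃ λ v → length u ≡ n × length v ≡ n × u ≢ v × x ≡ pairing u v
  ; Lneg     = λ n x → ∃ λ u → length u ≡ n × x ≡ pairing u u
  ; disjoint = λ { n x (u , v , _ , _ , u≢v , refl) (w , _ , eq) →
                   let (u≡w , v≡w) = pairing-injective eq in u≢v (trans u≡w (≡.sym v≡w)) }
  }

Inequality∈OneN : OneN Inequality
Inequality∈OneN = F , (Guess.automaton , (3 ∷ 4 ∷ [] , λ n → ℕ.≤-reflexive (stateCount≡ n)) , λ _ _ _ → refl) , pos , neg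
  where
  F : PartialFamily 3 ℕ
  F = record { Dom = λ _ _ → ⊤ ; fun = λ n x _ → #acc (Guess.automaton n) x }
  stateCount≡ : ∀ n → 3 + ((n + n) + (n + n)) ≡ 3 + n * (4 + n * 0)
  stateCount≡ = ℕ-Solver.solve-∀
  pos : ∀ n x → Lpos Inequality n x → ⊤ × 0 < #acc (Guess.automaton n) x
  pos n _ (u , v , refl , len-v , u≢v , refl)
    with a , x , u′ , y , v′ , refl , refl , y≢x , len′ ← first-difference u v (≡.sym len-v) u≢v =
    tt , Guess.start-pos _ a x u′ y v′ len′ u′<n y≢x
    where
    u′<n : length u′ < length (a ++ x ∷ u′)
    u′<n = ℕ.≤-trans (ℕ.m≤n+m (suc (length u′)) (length a)) (ℕ.≤-reflexive (≡.sym (length-++ a)))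
  neg : ∀ n x → Lneg Inequality n x → ⊤ × #acc (Guess.automaton n) x ≡ 0
  neg n _ (u , _ , refl) = tt , Guess.start-zero n u

bitStrings : ℕ → List (List Bool)
bitStrings zero    = [] ∷ []
bitStrings (suc n) = map (false ∷_) (bitStrings n) ++ map (true ∷_) (bitStrings n)

length-bitStrings : ∀ n → length (bitStrings n) ≡ 2 ^ n
length-bitStrings zero    = refl
length-bitStrings (suc n) = begin
  length (map (false ∷_) (bitStrings n) ++ map (true ∷_) (bitStrings n))
    ≡⟨ length-++ (map (false ∷_) (bitStrings n)) ⟩
  length (map (false ∷_) (bitStrings n)) + length (map (true ∷_) (bitStrings n))
    ≡⟨ cong₂ _+_ (length-map (false ∷_) (bitStrings n)) (length-map (true ∷_) (bitStrings n)) ⟩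
  length (bitStrings n) + length (bitStrings n)
    ≡⟨ cong₂ _+_ (length-bitStrings n) (trans (length-bitStrings n) (≡.sym (ℕ.+-identityʳ _))) ⟩
  2 ^ suc n ∎
  where open ≡-Reasoning

bitStrings-length : ∀ n → All (λ u → length u ≡ n) (bitStrings n)
bitStrings-length zero    = refl ∷ []
bitStrings-length (suc n) = AllP.++⁺ (AllP.map⁺ (All.map (cong suc) (bitStrings-length n)))
                                     (AllP.map⁺ (All.map (cong suc) (bitStrings-length n)))

bitStrings-unique : ∀ n → Unique (bitStrings n)
bitStrings-unique zero    = [] ∷ []
bitStrings-unique (suc n) =
  UniqueP.++⁺ (UniqueP.map⁺ ∷-injectiveʳ (bitStrings-unique n)) (UniqueP.map⁺ ∷-injectiveʳ (bitStrings-unique n)) disjoint-heads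
  where
  disjoint-heads : ∀ {v} → ¬ (v ∈ map (false ∷_) (bitStrings n) × v ∈ map (true ∷_) (bitStrings n))
  disjoint-heads (v∈f , v∈t) with _ , _ , refl ← ∈-map⁻ (false ∷_) v∈f with _ , _ , () ← ∈-map⁻ (true ∷_) v∈t

Inequality∉OneCeq : ¬ OneCeq Inequality
Inequality∉OneCeq (F , (M , (p , size≤p) , F≡gap) , pos , neg) = ℕ.<-irrefl refl (begin-strict
  2 ^ n                 ≡⟨ length-bitStrings n ⟨
  length (bitStrings n) ≤⟨ gap-rank-bound N left right diag pairs ⟩
  suc (states N)        ≤⟨ s≤s (size≤p n) ⟩
  suc (evalPoly p n)    <⟨ proj₂ (2^-dominates-evalPoly p) ⟩
  2 ^ n                 ∎)
  where
  open ℕ.≤-Reasoning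
  n = proj₁ (2^-dominates-evalPoly p)
  N = M n
  left right : List Bool → Str 3
  left  u = bits u ++ hashSym ∷ []
  right v = bits (reverse v)
  pairing-split : ∀ u v → pairing u v ≡ left u ++ right v
  pairing-split u v = ≡.sym (++-assoc (bits u) (hashSym ∷ []) (right v))
  diag : All (λ u → gap N (left u ++ right u) ≢ 0ℤ) (bitStrings n)
  diag = All.map (λ {u} len → let (d , f≢0) = neg n (pairing u u) (u , len , refl)
                              in λ gap≡0 → f≢0 (trans (F≡gap n _ d) (trans (cong (gap N) (pairing-split u u)) gap≡0)))
                 (bitStrings-length n)
  pairs : AllPairs (λ u v → gap N (left u ++ right v) ≡ 0ℤ) (bitStrings n)
  pairs = AllPairs-mapWith-All (bitStrings-length n)
            (λ {u} {v} len-u len-v u≢v → let (d , f≡0) = pos n (pairing u v) (u , v , len-u , len-v , u≢v , refl)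
                                         in trans (cong (gap N) (≡.sym (pairing-split u v))) (trans (≡.sym (F≡gap n _ d)) f≡0))
            (bitStrings-unique n)

theorem4p6 : ((OneN ⊊C coC OneCeq) × (coC OneN ⊊C OneCeq)) × ¬ (OneN ⊆C OneCeq)
theorem4p6 =
  ( (OneN⊆coOneCeq , 2 , Unbalanced , coUnbalanced∈OneCeq , Unbalanced∉OneN)
  , ((λ L → OneN⊆coOneCeq (co L)) , 2 , co Unbalanced , coUnbalanced∈OneCeq , Unbalanced∉OneN) )
  , λ OneN⊆OneCeq → Inequality∉OneCeq (OneN⊆OneCeq Inequality Inequality∈OneN)
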